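{- Let $h:\Sigma_4^*\to\Sigma_4^*$ (with $\Sigma_4=\{0,1,2,3\}$) be the morphism $h(0)=012$, $h(1)=302$, $h(2)=031$, $h(3)=321$. Then the infinite word $h^\omega(0)$ is squarefree.
   Context: $h^\omega(0)=\lim_n h^n(0)$ is the fixed point of $h$ starting with $0$. A square is a nonempty word $xx$; squarefree means containing no square as a contiguous subword. -}

module Defs where

open import Data.Nat using (ℕ; zero; suc; _+_; _*_; _^_; _<_; _≤_)
open import Data.Fin using (Fin; zero; suc)
open import Data.List using (List; []; _∷_; concatMap)
open import Data.Maybe using (Maybe; just; nothing)
open import Data.Product using (∃; _×_)
open import Relation.Nullary using (¬_)
open import Relation.Binary.PropositionalEquality using (_≡_)

Σ₄ : Set
Σ₄ = Fin 4

h₁ : Σ₄ → List Σ₄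
h₁ zero                   = zero ∷ suc zero ∷ suc (suc zero) ∷ []
h₁ (suc zero)             = suc (suc (suc zero)) ∷ zero ∷ suc (suc zero) ∷ []
h₁ (suc (suc zero))       = zero ∷ suc (suc (suc zero)) ∷ suc zero ∷ []
h₁ (suc (suc (suc zero))) = suc (suc (suc zero)) ∷ suc (suc zero) ∷ suc zero ∷ []

h : List Σ₄ → List Σ₄
h = concatMap h₁

iter : ℕ → List Σ₄ → List Σ₄
iter zero    w = w
iter (suc n) w = h (iter n w)

at : List Σ₄ → ℕ → Maybe Σ₄
at []       _       = nothing
at (x ∷ xs) zero    = just x
at (x ∷ xs) (suc i) = at xs i

-- h^ω(0) as a partial map: position i of the limit word is the letter at
-- position i of h^(i+1)(0) (which has length 3^(i+1) > i, and h^n(0) is a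
-- prefix of h^(n+1)(0) since h(0) starts with 0).
hω0 : ℕ → Maybe Σ₄
hω0 i = at (iter (suc i) (zero ∷ [])) i

SquareAt : (ℕ → Maybe Σ₄) → ℕ → ℕ → Set
SquareAt w i n = (1 ≤ n) × (∀ k → k < n → w (i + k) ≡ w (i + n + k))

Squarefree : (ℕ → Maybe Σ₄) → Set
Squarefree w = ∀ i n → ¬ SquareAt w i n

-- A fixed point w of h satisfies w(3j + r) = (h(w j))ᵣ, and h is a uniform
-- 3-morphism whose images begin with 0 or 3, end with 1 or 2, and have pairwise
-- distinct middle letters. Take a square of half-length n in w. If 3 ∤ n, some
-- letter in the first half sits at the end of a block while its copy n places
-- later sits at the start of a block (or vice versa), which is impossible;
-- only n = 1 and n = 2 need a direct look at the blocks. If n = 3m, the middle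
-- letters of the blocks inside the square form a square of half-length m in
-- the preimage, since middle letters determine the block; so by descent there
-- is no square at all.
module Submission where

open import Defs
open import Data.Nat
  using (ℕ; zero; suc; _+_; _*_; _<_; _≤_; _≤′_; ≤′-refl; ≤′-step; z≤n; s≤s; >-nonZero)
open import Data.Nat.Properties
  using ( +-comm; +-suc; <-trans; ≤-trans; +-monoˡ-≤; *-monoˡ-≤; m≤m+n; m≤n+m; m≤m*n
        ; n≤1+n; n<1+n; m<m*n; ≤⇒≤′; ≤′⇒≤; module ≤-Reasoning)
open import Data.Nat.Induction using (<-rec)
open import Data.Nat.Tactic.RingSolver using (solve-∀)
open import Data.Fin using (Fin; zero; suc; toℕ)
open import Data.Fin.Properties using (all?; _≟_; toℕ≤pred[n])
open import Data.List using (List; []; _∷_; _++_; length; map; concat)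
open import Data.List.Properties using (length-++; map-++; concat-++)
open import Data.Maybe using (just)
import Data.Maybe as Maybe
open import Data.Maybe.Properties using (just-injective)
open import Data.Product using (∃; ∃₂; _×_; _,_; proj₁; proj₂)
open import Relation.Nullary using (¬_)
open import Relation.Nullary.Decidable using (from-yes; ¬?; _×-dec_; _→-dec_)
open import Relation.Binary.PropositionalEquality

pattern first  = zero
pattern middle = suc zero
pattern last   = suc (suc zero)

letter : Σ₄ → Fin 3 → Σ₄
letter zero                   first  = zero
letter zero                   middle = suc zero
letter zero                   last   = suc (suc zero)
letter (suc zero)             first  = suc (suc (suc zero))
letter (suc zero)             middle = zero
letter (suc zero)             last   = suc (suc zero)
letter (suc (suc zero))       first  = zero
letter (suc (suc zero))       middle = suc (suc (suc zero))
letter (suc (suc zero))       last   = suc zero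
letter (suc (suc (suc zero))) first  = suc (suc (suc zero))
letter (suc (suc (suc zero))) middle = suc (suc zero)
letter (suc (suc (suc zero))) last   = suc zero

h₁-letters : ∀ x → h₁ x ≡ letter x first ∷ letter x middle ∷ letter x last ∷ []
h₁-letters zero                   = refl
h₁-letters (suc zero)             = refl
h₁-letters (suc (suc zero))       = refl
h₁-letters (suc (suc (suc zero))) = refl

letter-middle-injective : ∀ x y → letter x middle ≡ letter y middle → x ≡ y
letter-middle-injective =
  from-yes (all? λ x → all? λ y → letter x middle ≟ letter y middle →-dec x ≟ y)

letter-last≢first : ∀ x y → letter x last ≢ letter y first
letter-last≢first = from-yes (all? λ x → all? λ y → ¬? (letter x last ≟ letter y first))

letter-first≢middle : ∀ x → letter x first ≢ letter x middle
letter-first≢middle = from-yes (all? λ x → ¬? (letter x first ≟ letter x middle))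

letter-middle≢last : ∀ x → letter x middle ≢ letter x last
letter-middle≢last = from-yes (all? λ x → ¬? (letter x middle ≟ letter x last))

letter-suffix₂≢prefix₂ : ∀ x y →
  ¬ (letter x middle ≡ letter y first × letter x last ≡ letter y middle)
letter-suffix₂≢prefix₂ = from-yes (all? λ x → all? λ y →
  ¬? (letter x middle ≟ letter y first ×-dec letter x last ≟ letter y middle))

data DivMod3 : ℕ → Set where
  _+3*_ : ∀ (r : Fin 3) q → DivMod3 (toℕ r + q * 3)

divMod3 : ∀ n → DivMod3 n
divMod3 zero = first +3* 0
divMod3 (suc n) with divMod3 n
... | first  +3* q = middle +3* q
... | middle +3* q = last +3* q
... | last   +3* q = first +3* suc q

offset-to-residue : ∀ i (s : Fin 3) → ∃₂ λ k a → k ≤ 2 × k + i ≡ toℕ s + a * 3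
offset-to-residue zero    s = toℕ s , 0 , toℕ≤pred[n] s , refl
offset-to-residue (suc i) s with offset-to-residue i s
... | suc k , a , s≤s k≤1 , k+i≡ = k , a , ≤-trans k≤1 (s≤s z≤n) , trans (+-suc k i) k+i≡
... | zero  , a , _       , i≡   =
  2 , suc a , s≤s (s≤s z≤n) , trans (cong (3 +_) i≡) (rotate (toℕ s) a)
  where
  rotate : ∀ s a → 3 + (s + a * 3) ≡ s + suc a * 3
  rotate = solve-∀

IsFixedPoint : (ℕ → Σ₄) → Set
IsFixedPoint w = ∀ j r → w (toℕ r + j * 3) ≡ letter (w j) r

-- Offsets are added on the left, so that k + i computes for numerals k.
Square : (ℕ → Σ₄) → ℕ → ℕ → Set
Square w i n = ∀ k → k < n → w (k + i) ≡ w (k + n + i)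

≤2⇒<3+ : ∀ {k} n → k ≤ 2 → k < 3 + n
≤2⇒<3+ n k≤2 = ≤-trans (s≤s k≤2) (m≤m+n 3 n)

k+n+i≡n+[k+i] : ∀ k n i → k + n + i ≡ n + (k + i)
k+n+i≡n+[k+i] = solve-∀

module _ {w : ℕ → Σ₄} (fixed : IsFixedPoint w) where

  letters-agree : ∀ {p q} j r j′ r′ → p ≡ toℕ r + j * 3 → q ≡ toℕ r′ + j′ * 3 →
                  w p ≡ w q → letter (w j) r ≡ letter (w j′) r′
  letters-agree j r j′ r′ refl refl wp≡wq =
    trans (sym (fixed j r)) (trans wp≡wq (fixed j′ r′))

  no-square₁ : ∀ i → ¬ Square w i 1
  no-square₁ i square with divMod3 i
  ... | first +3* j =
    letter-first≢middle (w j) (letters-agree j first j middle refl refl (square 0 (s≤s z≤n)))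
  ... | middle +3* j =
    letter-middle≢last (w j) (letters-agree j middle j last refl refl (square 0 (s≤s z≤n)))
  ... | last +3* j =
    letter-last≢first (w j) (w (suc j))
      (letters-agree j last (suc j) first refl refl (square 0 (s≤s z≤n)))

  no-square₂ : ∀ i → ¬ Square w i 2
  no-square₂ i square with divMod3 i
  ... | first +3* j =
    letter-last≢first (w j) (w j) (sym (letters-agree j first j last refl refl (square 0 (s≤s z≤n))))
  ... | middle +3* j =
    letter-suffix₂≢prefix₂ (w j) (w (suc j))
      ( letters-agree j middle (suc j) first refl refl (square 0 (s≤s z≤n))
      , letters-agree j last (suc j) middle refl refl (square 1 (s≤s (s≤s z≤n))))
  ... | last +3* j =
    letter-last≢first (w (suc j)) (w (suc j))
      (sym (letters-agree (suc j) first (suc j) last refl refl (square 1 (s≤s (s≤s z≤n)))))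

  no-square-1mod3 : ∀ i m → ¬ Square w i (1 + suc m * 3)
  no-square-1mod3 i m square with offset-to-residue i last
  ... | k , a , k≤2 , k+i≡ =
    letter-last≢first (w a) (w (2 + m + a))
      (letters-agree a last (2 + m + a) first k+i≡ copy (square k (≤2⇒<3+ _ k≤2)))
    where
    n = 1 + suc m * 3
    arrange : ∀ m a → (1 + suc m * 3) + (2 + a * 3) ≡ (2 + m + a) * 3
    arrange = solve-∀
    copy : k + n + i ≡ (2 + m + a) * 3
    copy = trans (k+n+i≡n+[k+i] k n i) (trans (cong (n +_) k+i≡) (arrange m a))

  no-square-2mod3 : ∀ i m → ¬ Square w i (2 + suc m * 3)
  no-square-2mod3 i m square with offset-to-residue i first
  ... | k , a , k≤2 , k+i≡ =
    letter-last≢first (w (suc m + a)) (w a)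
      (sym (letters-agree a first (suc m + a) last k+i≡ copy (square k (≤2⇒<3+ _ k≤2))))
    where
    n = 2 + suc m * 3
    arrange : ∀ m a → (2 + suc m * 3) + a * 3 ≡ 2 + (suc m + a) * 3
    arrange = solve-∀
    copy : k + n + i ≡ 2 + (suc m + a) * 3
    copy = trans (k+n+i≡n+[k+i] k n i) (trans (cong (n +_) k+i≡) (arrange m a))

  square-desubstitutes : ∀ i m → Square w i (m * 3) → ∃ λ j → Square w j m
  square-desubstitutes i m square with offset-to-residue i middle
  ... | k , j , k≤2 , k+i≡ = j , λ t t<m →
    letter-middle-injective (w (t + j)) (w (t + m + j))
      (letters-agree (t + j) middle (t + m + j) middle
        (middle-of t) (trans (cong (_+ i) (merge k t m)) (middle-of (t + m)))
        (square (k + t * 3) (inside t<m)))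
    where
    middle-of : ∀ x → k + x * 3 + i ≡ 1 + (x + j) * 3
    middle-of x = trans (swap k x i) (trans (cong (x * 3 +_) k+i≡) (collect x j))
      where
      swap : ∀ k x i → k + x * 3 + i ≡ x * 3 + (k + i)
      swap = solve-∀
      collect : ∀ x j → x * 3 + (1 + j * 3) ≡ 1 + (x + j) * 3
      collect = solve-∀
    merge : ∀ k t m → k + t * 3 + m * 3 ≡ k + (t + m) * 3
    merge = solve-∀
    inside : ∀ {t} → t < m → k + t * 3 < m * 3
    inside {t} t<m = begin-strict
      k + t * 3     <⟨ +-monoˡ-≤ (t * 3) (s≤s k≤2) ⟩
      suc t * 3     ≤⟨ *-monoˡ-≤ 3 t<m ⟩
      m * 3         ∎
      where open ≤-Reasoning

  squarefree : ∀ n i → 1 ≤ n → ¬ Square w i n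
  squarefree = <-rec _ go
    where
    go : ∀ n → (∀ {m} → m < n → ∀ j → 1 ≤ m → ¬ Square w j m) → ∀ i → 1 ≤ n → ¬ Square w i n
    go n descend i 1≤n square with divMod3 n
    ... | first  +3* zero  with () ← 1≤n
    ... | first  +3* suc m = let j , square′ = square-desubstitutes i (suc m) square
                             in descend (m<m*n (suc m) 3 (s≤s (s≤s z≤n))) j (s≤s z≤n) square′
    ... | middle +3* zero  = no-square₁ i square
    ... | middle +3* suc m = no-square-1mod3 i m square
    ... | last   +3* zero  = no-square₂ i square
    ... | last   +3* suc m = no-square-2mod3 i m square

h-++ : ∀ u v → h (u ++ v) ≡ h u ++ h v
h-++ u v = trans (cong concat (map-++ h₁ u v)) (sym (concat-++ (map h₁ u) (map h₁ v)))

iter-++ : ∀ n u v → iter n (u ++ v) ≡ iter n u ++ iter n v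
iter-++ zero    u v = refl
iter-++ (suc n) u v = trans (cong h (iter-++ n u v)) (h-++ (iter n u) (iter n v))

iter-suc : ∀ n w → iter (suc n) w ≡ iter n (h w)
iter-suc zero    w = refl
iter-suc (suc n) w = cong h (iter-suc n w)

length-h : ∀ u → length (h u) ≡ length u * 3
length-h []      = refl
length-h (x ∷ u) = begin
  length (h₁ x ++ h u)           ≡⟨ length-++ (h₁ x) ⟩
  length (h₁ x) + length (h u)   ≡⟨ cong₂ _+_ (cong length (h₁-letters x)) (length-h u) ⟩
  3 + length u * 3               ∎
  where open ≡-Reasoning

at-++ : ∀ u v {i} → i < length u → at (u ++ v) i ≡ at u i
at-++ (x ∷ u) v {zero}  _         = refl
at-++ (x ∷ u) v {suc i} (s≤s i<n) = at-++ u v i<n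

at-just : ∀ u {i} → i < length u → ∃ λ x → at u i ≡ just x
at-just (x ∷ u) {zero}  _         = x , refl
at-just (x ∷ u) {suc i} (s≤s i<n) = at-just u i<n

at-h : ∀ u j r → at (h u) (toℕ r + j * 3) ≡ Maybe.map (λ x → letter x r) (at u j)
at-h []      j r = refl
at-h (x ∷ u) j r =
  trans (cong (λ v → at (v ++ h u) (toℕ r + j * 3)) (h₁-letters x)) (at-block j r)
  where
  at-block : ∀ j r → at (letter x first ∷ letter x middle ∷ letter x last ∷ h u) (toℕ r + j * 3)
                   ≡ Maybe.map (λ y → letter y r) (at (x ∷ u) j)
  at-block zero    first  = refl
  at-block zero    middle = refl
  at-block zero    last   = refl
  at-block (suc j) first  = at-h u j first
  at-block (suc j) middle = at-h u j middle
  at-block (suc j) last   = at-h u j last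

[0] : List Σ₄
[0] = zero ∷ []

iter-prefix : ∀ n → iter (suc n) [0] ≡ iter n [0] ++ iter n (suc zero ∷ suc (suc zero) ∷ [])
iter-prefix n = trans (iter-suc n [0]) (iter-++ n [0] (suc zero ∷ suc (suc zero) ∷ []))

n<length-iter : ∀ n → n < length (iter n [0])
n<length-iter zero    = s≤s z≤n
n<length-iter (suc n) = begin-strict
  suc n           <⟨ s≤s n<L ⟩
  suc L           ≤⟨ m<m*n L 3 ⦃ >-nonZero (≤-trans (s≤s z≤n) n<L) ⦄ (s≤s (s≤s z≤n)) ⟩
  L * 3           ≡⟨ length-h (iter n [0]) ⟨
  length (iter (suc n) [0]) ∎
  where
  open ≤-Reasoning
  L = length (iter n [0])
  n<L = n<length-iter n

at-iter-stable′ : ∀ {i m} → suc i ≤′ m → at (iter m [0]) i ≡ hω0 i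
at-iter-stable′ ≤′-refl = refl
at-iter-stable′ {i} {suc m} (≤′-step i<m) = begin
  at (iter (suc m) [0]) i  ≡⟨ cong (λ u → at u i) (iter-prefix m) ⟩
  at (iter m [0] ++ _) i   ≡⟨ at-++ (iter m [0]) _ (<-trans (≤′⇒≤ i<m) (n<length-iter m)) ⟩
  at (iter m [0]) i        ≡⟨ at-iter-stable′ i<m ⟩
  hω0 i                    ∎
  where open ≡-Reasoning

at-iter-stable : ∀ {i m} → i < m → at (iter m [0]) i ≡ hω0 i
at-iter-stable i<m = at-iter-stable′ (≤⇒≤′ i<m)

hω0-defined : ∀ i → ∃ λ x → hω0 i ≡ just x
hω0-defined i = at-just (iter (suc i) [0]) (<-trans (n<1+n i) (n<length-iter (suc i)))

word : ℕ → Σ₄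
word i = proj₁ (hω0-defined i)

hω0≡just-word : ∀ i → hω0 i ≡ just (word i)
hω0≡just-word i = proj₂ (hω0-defined i)

hω0≡⇒word≡ : ∀ p q → hω0 p ≡ hω0 q → word p ≡ word q
hω0≡⇒word≡ p q hω0p≡hω0q =
  just-injective (trans (sym (hω0≡just-word p)) (trans hω0p≡hω0q (hω0≡just-word q)))

hω0-block : ∀ j r → hω0 (toℕ r + j * 3) ≡ Maybe.map (λ x → letter x r) (hω0 j)
hω0-block j r = begin
  hω0 p                                ≡⟨ at-iter-stable (s≤s (n≤1+n p)) ⟨
  at (h (iter (suc p) [0])) p          ≡⟨ at-h (iter (suc p) [0]) j r ⟩
  letter-r (at (iter (suc p) [0]) j)   ≡⟨ cong letter-r (at-iter-stable j<1+p) ⟩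
  letter-r (hω0 j)                     ∎
  where
  open ≡-Reasoning
  p = toℕ r + j * 3
  letter-r = Maybe.map (λ x → letter x r)
  j<1+p : j < suc p
  j<1+p = s≤s (≤-trans (m≤m*n j 3) (m≤n+m (j * 3) (toℕ r)))

word-isFixedPoint : IsFixedPoint word
word-isFixedPoint j r = just-injective (begin
  just (word (toℕ r + j * 3))            ≡⟨ hω0≡just-word (toℕ r + j * 3) ⟨
  hω0 (toℕ r + j * 3)                    ≡⟨ hω0-block j r ⟩
  Maybe.map (λ x → letter x r) (hω0 j)   ≡⟨ cong (Maybe.map (λ x → letter x r)) (hω0≡just-word j) ⟩
  just (letter (word j) r)               ∎)
  where open ≡-Reasoning

lemma15 : Squarefree hω0
lemma15 i n (1≤n , square) = squarefree word-isFixedPoint n i 1≤n λ k k<n → begin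
  word (k + i)      ≡⟨ cong word (+-comm k i) ⟩
  word (i + k)      ≡⟨ hω0≡⇒word≡ (i + k) (i + n + k) (square k k<n) ⟩
  word (i + n + k)  ≡⟨ cong word (reorder i n k) ⟩
  word (k + n + i)  ∎
  where
  open ≡-Reasoning
  reorder : ∀ i n k → i + n + k ≡ k + n + i
  reorder = solve-∀
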